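{- Let $m\geq 1$ be an integer, $S=\{1,2,\ldots,2m+1\}$ and $X$ the set of all $m$-subsets of $S$. Let $\mathcal{I}_m$ be the set of all four-tuples $(|x\cap y|,\,|x\cap z|,\,|y\cap z|,\,|x\cap y\cap z|)$ with $x,y,z\in X$. Then \[ \mathcal{I}_m=\big\{(i,j,t,p)\in\mathbb{Z}^4\mid 0\leq i,j\leq m,\ \max\{i+j-m,\,m-1-i-j\}\leq t\leq m-|i-j|,\ \max\{0,\,i+j-m,\,i+t-m,\,j+t-m\}\leq p\leq \min\{i,\,j,\,t,\,i+j+t+1-m\}\big\}, \] and $|\mathcal{I}_m|=\binom{m+4}{4}$. -}

module Defs where

open import Data.Nat using (ℕ; suc; _+_; _*_)
open import Data.Integer as ℤ using (ℤ; +_; _-_; _≤_; _⊔_; _⊓_; ∣_∣)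
open import Data.Fin.Subset using (Subset; _∩_; ∣_∣)
open import Data.Product using (_×_; Σ; ∃-syntax; _,_)
open import Relation.Binary.PropositionalEquality using (_≡_)

-- S = {1,...,2m+1} is modelled by Fin (2m+1); subsets of S as 'Subset (2m+1)'.
S-size : ℕ → ℕ
S-size m = suc (2 * m)

IsInX : (m : ℕ) → Subset (S-size m) → Set
IsInX m x = Data.Fin.Subset.∣ x ∣ ≡ m

Quad : Set
Quad = ℤ × ℤ × ℤ × ℤ

InI : (m : ℕ) → Quad → Set
InI m (i , j , t , p) =
  ∃[ x ] ∃[ y ] ∃[ z ]
    (IsInX m x × IsInX m y × IsInX m z ×
     i ≡ + Data.Fin.Subset.∣ x ∩ y ∣ ×
     j ≡ + Data.Fin.Subset.∣ x ∩ z ∣ ×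
     t ≡ + Data.Fin.Subset.∣ y ∩ z ∣ ×
     p ≡ + Data.Fin.Subset.∣ (x ∩ y) ∩ z ∣)

RHS : (m : ℕ) → Quad → Set
RHS m (i , j , t , p) =
  (+ 0 ≤ i) × (i ≤ + m) × (+ 0 ≤ j) × (j ≤ + m) ×
  (((i ℤ.+ j) - + m) ⊔ ((+ m - + 1) - (i ℤ.+ j)) ≤ t) ×
  (t ≤ + m - + (ℤ.∣ i - j ∣)) ×
  ((+ 0 ⊔ ((i ℤ.+ j) - + m)) ⊔ (((i ℤ.+ t) - + m) ⊔ ((j ℤ.+ t) - + m)) ≤ p) ×
  (p ≤ (i ⊓ j) ⊓ (t ⊓ (((i ℤ.+ j) ℤ.+ t ℤ.+ + 1) - + m)))

-- Three subsets x, y, z of S are described, up to a permutation of S, by the sizes of their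
-- eight Venn regions, and inclusion–exclusion recovers these sizes from |S| = 2m+1,
-- |x| = |y| = |z| = m and (i, j, t, p) = (|x∩y|, |x∩z|, |y∩z|, |x∩y∩z|).  So (i, j, t, p) is
-- realized exactly when the eight inclusion–exclusion expressions are nonnegative, and these
-- eight inequalities unfold to the stated bounds.  The realized quadruples are in bijection with
-- the C(m+4, 4) lattice points (a, b, c, d) ≥ 0, a + b + c + d ≤ m of a 4-simplex: a quadruple
-- whose four regions lying in at least two of the sets have sizes (p, i−p, j−p, t−p) summing to
-- at most m corresponds to these sizes, any other to (i+j+t−2p−m−1, |z only|, |y only|, |x only|).
module Submission where

open import Defs
open import Data.Bool using (Bool; true; false)
open import Data.Nat as ℕ using (ℕ; zero; suc; _≥_; z≤n; s≤s)
import Data.Nat.Properties as ℕₚ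
open import Data.Nat.Combinatorics using (_C_; nCn≡1; nCk+nC[k+1]≡[n+1]C[k+1])
open import Data.Integer using (ℤ; +_; 0ℤ; 1ℤ; _-_; -_; _≤_; _⊔_; _⊓_; ∣_∣; +≤+)
open import Data.Integer.Properties
  using ( _≤?_; +-injective; pos-+; 0≤i⇒+∣i∣≡i; +∣i∣≡i⊎+∣i∣≡-i; drop‿+≤+; +-mono-≤; ≤-trans
        ; i≤j⇒0≤j-i; 0≤i-j⇒j≤i; ≰⇒>; i<j⇒suc[i]≤j; ⊔-lub; ⊓-glb; i≤i⊔j; i≤j⊔i; i⊓j≤i; i⊓j≤j )
open import Data.Integer.Tactic.RingSolver using (solve-∀; solve)
open import Data.Vec as Vec using (Vec; sum)
open import Data.Vec.Properties using (∷-injectiveʳ)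
open import Data.Fin.Subset using (Subset; _∩_) renaming (∣_∣ to ∣_∣ˢ)
open import Data.List using (List; []; _∷_; map; _++_; length)
open import Data.List.Properties using (length-map; length-++; map-∘; map-id-local)
open import Data.List.Membership.Propositional using (_∈_)
open import Data.List.Membership.Propositional.Properties
  using (∈-map⁺; ∈-map⁻; ∈-++⁺ˡ; ∈-++⁺ʳ; ∈-++⁻)
open import Data.List.Relation.Unary.Any using (here)
open import Data.List.Relation.Unary.All using (tabulate; [])
open import Data.List.Relation.Unary.AllPairs using ([]; _∷_)
open import Data.List.Relation.Unary.Unique.Propositional using (Unique)
import Data.List.Relation.Unary.Unique.Propositional.Properties as Unique
open import Data.Product using (Σ; ∃-syntax; _×_; _,_; proj₁; proj₂)
open import Data.Sum using (inj₁; inj₂)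
open import Data.Empty using (⊥; ⊥-elim)
open import Function.Bundles using (_⇔_; mk⇔; Equivalence)
open import Function.Construct.Composition using (_⇔-∘_)
open import Function.Construct.Symmetry using (⇔-sym)
open import Relation.Binary.PropositionalEquality
open import Relation.Nullary using (¬_; yes; no)

-- Integer addition is opened only inside this module: the statement at the end uses ℕ's _+_.
module _ where
  open import Data.Integer using (_+_)

  -- Venn diagrams of three sets and their measured sizes

  data Venn (A : Set) : Set where
    venn : (xyz xy xz yz x y z none : A) → Venn A

  mapVenn : {A B : Set} → (A → B) → Venn A → Venn B
  mapVenn f (venn a b c d e g h k) = venn (f a) (f b) (f c) (f d) (f e) (f g) (f h) (f k)

  zipVenn : {A B C : Set} → (A → B → C) → Venn A → Venn B → Venn C
  zipVenn f (venn a b c d e g h k) (venn a′ b′ c′ d′ e′ g′ h′ k′) =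
    venn (f a a′) (f b b′) (f c c′) (f d d′) (f e e′) (f g g′) (f h h′) (f k k′)

  AllVenn : {A : Set} → (A → Set) → Venn A → Set
  AllVenn P (venn a b c d e f g h) = P a × P b × P c × P d × P e × P f × P g × P h

  venn-≡ : {A : Set} {a b c d e f g h a′ b′ c′ d′ e′ f′ g′ h′ : A} →
    a ≡ a′ → b ≡ b′ → c ≡ c′ → d ≡ d′ → e ≡ e′ → f ≡ f′ → g ≡ g′ → h ≡ h′ →
    venn a b c d e f g h ≡ venn a′ b′ c′ d′ e′ f′ g′ h′
  venn-≡ refl refl refl refl refl refl refl refl = refl

  data Profile : Set where
    profile : (points sx sy sz sxy sxz syz sxyz : ℤ) → Profile

  profile-≡ : ∀ {a b c d e f g h a′ b′ c′ d′ e′ f′ g′ h′ : ℤ} →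
    a ≡ a′ → b ≡ b′ → c ≡ c′ → d ≡ d′ → e ≡ e′ → f ≡ f′ → g ≡ g′ → h ≡ h′ →
    profile a b c d e f g h ≡ profile a′ b′ c′ d′ e′ f′ g′ h′
  profile-≡ refl refl refl refl refl refl refl refl = refl

  profile-injective : ∀ {a b c d e f g h a′ b′ c′ d′ e′ f′ g′ h′ : ℤ} →
    profile a b c d e f g h ≡ profile a′ b′ c′ d′ e′ f′ g′ h′ →
    a ≡ a′ × b ≡ b′ × c ≡ c′ × d ≡ d′ × e ≡ e′ × f ≡ f′ × g ≡ g′ × h ≡ h′
  profile-injective refl = refl , refl , refl , refl , refl , refl , refl , refl

  _⊕_ : Profile → Profile → Profile
  profile a b c d e f g h ⊕ profile a′ b′ c′ d′ e′ f′ g′ h′ =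
    profile (a + a′) (b + b′) (c + c′) (d + d′) (e + e′) (f + f′) (g + g′) (h + h′)

  sizes : Venn ℤ → Profile
  sizes (venn xyz xy xz yz x y z none) =
    profile ((xyz + xy + xz + x) + (yz + y + z + none))
            (xyz + xy + xz + x) (xyz + xy + yz + y) (xyz + xz + yz + z)
            (xyz + xy) (xyz + xz) (xyz + yz) xyz

  regions : Profile → Venn ℤ
  regions (profile n a b c ab ac bc abc) =
    venn abc (ab - abc) (ac - abc) (bc - abc)
         (a - ab - ac + abc) (b - ab - bc + abc) (c - ac - bc + abc)
         (n - a - b - c + ab + ac + bc - abc)

  +-interchange₂ : ∀ a b a′ b′ → (a + a′) + (b + b′) ≡ (a + b) + (a′ + b′)
  +-interchange₂ = solve-∀

  +-interchange₄ : ∀ a b c d a′ b′ c′ d′ →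
    (a + a′) + (b + b′) + (c + c′) + (d + d′) ≡ (a + b + c + d) + (a′ + b′ + c′ + d′)
  +-interchange₄ = solve-∀

  -- Kept opaque: otherwise checking sizes-⊕ unfolds this proof, which takes minutes.
  opaque
    +-interchange₄₊₄ : ∀ a b c d e f g h a′ b′ c′ d′ e′ f′ g′ h′ →
      ((a + a′) + (b + b′) + (c + c′) + (d + d′)) + ((e + e′) + (f + f′) + (g + g′) + (h + h′)) ≡
      ((a + b + c + d) + (e + f + g + h)) + ((a′ + b′ + c′ + d′) + (e′ + f′ + g′ + h′))
    +-interchange₄₊₄ a b c d e f g h a′ b′ c′ d′ e′ f′ g′ h′ =
      trans (cong₂ _+_ (+-interchange₄ a b c d a′ b′ c′ d′) (+-interchange₄ e f g h e′ f′ g′ h′))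
            (+-interchange₂ (a + b + c + d) (e + f + g + h) (a′ + b′ + c′ + d′) (e′ + f′ + g′ + h′))

  sizes-⊕ : ∀ U V → sizes (zipVenn _+_ U V) ≡ sizes U ⊕ sizes V
  sizes-⊕ (venn a b c d e f g h) (venn a′ b′ c′ d′ e′ f′ g′ h′) = profile-≡
    (+-interchange₄₊₄ a b c e d f g h a′ b′ c′ e′ d′ f′ g′ h′)
    (+-interchange₄ a b c e a′ b′ c′ e′) (+-interchange₄ a b d f a′ b′ d′ f′)
    (+-interchange₄ a c d g a′ c′ d′ g′)
    (+-interchange₂ a b a′ b′) (+-interchange₂ a c a′ c′) (+-interchange₂ a d a′ d′)
    refl

  regions-sizes : ∀ V → regions (sizes V) ≡ V
  regions-sizes (venn a b c d e f g h) = venn-≡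
    refl (cancel₂ a b) (cancel₂ a c) (cancel₂ a d)
    (cancel₄ a b c e) (cancel₄ a b d f) (cancel₄ a c d g)
    (cancel₈ a b c d e f g h)
    where
    cancel₂ : ∀ a b → (a + b) - a ≡ b
    cancel₂ = solve-∀
    cancel₄ : ∀ a b c d → (a + b + c + d) - (a + b) - (a + c) + a ≡ d
    cancel₄ = solve-∀
    cancel₈ : ∀ a b c d e f g h →
      ((a + b + c + e) + (d + f + g + h)) - (a + b + c + e) - (a + b + d + f) - (a + c + d + g)
        + (a + b) + (a + c) + (a + d) - a ≡ h
    cancel₈ = solve-∀

  sizes-regions : ∀ P → sizes (regions P) ≡ P
  sizes-regions (profile n a b c ab ac bc abc) = profile-≡
    (telescope₈ n a b c ab ac bc abc)
    (telescope₄ a ab ac abc) (telescope₄ b ab bc abc) (telescope₄ c ac bc abc)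
    (telescope₂ ab abc) (telescope₂ ac abc) (telescope₂ bc abc)
    refl
    where
    telescope₂ : ∀ ab abc → abc + (ab - abc) ≡ ab
    telescope₂ = solve-∀
    telescope₄ : ∀ a ab ac abc → abc + (ab - abc) + (ac - abc) + (a - ab - ac + abc) ≡ a
    telescope₄ = solve-∀
    -- Opaque for the same reason as +-interchange₄₊₄.
    opaque
      telescope₈ : ∀ n a b c ab ac bc abc →
        (abc + (ab - abc) + (ac - abc) + (a - ab - ac + abc)) + ((bc - abc) + (b - ab - bc + abc)
          + (c - ac - bc + abc) + (n - a - b - c + ab + ac + bc - abc)) ≡ n
      telescope₈ = solve-∀

  toℤ : Venn ℕ → Venn ℤ
  toℤ = mapVenn (λ n → + n)

  toℤ-zipVenn : ∀ (U V : Venn ℕ) → toℤ (zipVenn ℕ._+_ U V) ≡ zipVenn _+_ (toℤ U) (toℤ V)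
  toℤ-zipVenn (venn _ _ _ _ _ _ _ _) (venn _ _ _ _ _ _ _ _) = refl

  toℤ-nonNegative : ∀ v → AllVenn (0ℤ ≤_) (toℤ v)
  toℤ-nonNegative (venn _ _ _ _ _ _ _ _) =
    +≤+ z≤n , +≤+ z≤n , +≤+ z≤n , +≤+ z≤n , +≤+ z≤n , +≤+ z≤n , +≤+ z≤n , +≤+ z≤n

  toℤ-∣∣ : ∀ V → AllVenn (0ℤ ≤_) V → toℤ (mapVenn ∣_∣ V) ≡ V
  toℤ-∣∣ (venn _ _ _ _ _ _ _ _) (a , b , c , d , e , f , g , h) =
    venn-≡ (0≤i⇒+∣i∣≡i a) (0≤i⇒+∣i∣≡i b) (0≤i⇒+∣i∣≡i c) (0≤i⇒+∣i∣≡i d)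
           (0≤i⇒+∣i∣≡i e) (0≤i⇒+∣i∣≡i f) (0≤i⇒+∣i∣≡i g) (0≤i⇒+∣i∣≡i h)

  point : Bool → Bool → Bool → Venn ℕ
  point true  true  true  = venn 1 0 0 0 0 0 0 0
  point true  true  false = venn 0 1 0 0 0 0 0 0
  point true  false true  = venn 0 0 1 0 0 0 0 0
  point false true  true  = venn 0 0 0 1 0 0 0 0
  point true  false false = venn 0 0 0 0 1 0 0 0
  point false true  false = venn 0 0 0 0 0 1 0 0
  point false false true  = venn 0 0 0 0 0 0 1 0
  point false false false = venn 0 0 0 0 0 0 0 1

  vennOf : ∀ {n} → Subset n → Subset n → Subset n → Venn ℕ
  vennOf Vec.[]       Vec.[]       Vec.[]       = venn 0 0 0 0 0 0 0 0
  vennOf (a Vec.∷ x) (b Vec.∷ y) (c Vec.∷ z) = zipVenn ℕ._+_ (point a b c) (vennOf x y z)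

  profileOf : ∀ {n} → Subset n → Subset n → Subset n → Profile
  profileOf {n} x y z =
    profile (+ n) (+ ∣ x ∣ˢ) (+ ∣ y ∣ˢ) (+ ∣ z ∣ˢ)
            (+ ∣ x ∩ y ∣ˢ) (+ ∣ x ∩ z ∣ˢ) (+ ∣ y ∩ z ∣ˢ) (+ ∣ (x ∩ y) ∩ z ∣ˢ)

  profileOf-∷ : ∀ {n} a b c (x y z : Subset n) →
    profileOf (a Vec.∷ x) (b Vec.∷ y) (c Vec.∷ z) ≡ sizes (toℤ (point a b c)) ⊕ profileOf x y z
  profileOf-∷ true  true  true  x y z = refl
  profileOf-∷ true  true  false x y z = refl
  profileOf-∷ true  false true  x y z = refl
  profileOf-∷ false true  true  x y z = refl
  profileOf-∷ true  false false x y z = refl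
  profileOf-∷ false true  false x y z = refl
  profileOf-∷ false false true  x y z = refl
  profileOf-∷ false false false x y z = refl

  profileOf-vennOf : ∀ {n} (x y z : Subset n) → profileOf x y z ≡ sizes (toℤ (vennOf x y z))
  profileOf-vennOf Vec.[] Vec.[] Vec.[] = refl
  profileOf-vennOf (a Vec.∷ x) (b Vec.∷ y) (c Vec.∷ z) = begin
    profileOf (a Vec.∷ x) (b Vec.∷ y) (c Vec.∷ z)
      ≡⟨ profileOf-∷ a b c x y z ⟩
    sizes (toℤ (point a b c)) ⊕ profileOf x y z
      ≡⟨ cong (sizes (toℤ (point a b c)) ⊕_) (profileOf-vennOf x y z) ⟩
    sizes (toℤ (point a b c)) ⊕ sizes (toℤ (vennOf x y z))
      ≡⟨ sizes-⊕ (toℤ (point a b c)) (toℤ (vennOf x y z)) ⟨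
    sizes (zipVenn _+_ (toℤ (point a b c)) (toℤ (vennOf x y z)))
      ≡⟨ cong sizes (toℤ-zipVenn (point a b c) (vennOf x y z)) ⟨
    sizes (toℤ (vennOf (a Vec.∷ x) (b Vec.∷ y) (c Vec.∷ z))) ∎
    where open ≡-Reasoning

  Realization : Venn ℕ → Set
  Realization v =
    Σ ℕ λ n → Σ (Subset n) λ x → Σ (Subset n) λ y → Σ (Subset n) λ z → vennOf x y z ≡ v

  extend : ∀ a b c {v} → Realization v → Realization (zipVenn ℕ._+_ (point a b c) v)
  extend a b c (n , x , y , z , vennOf≡v) =
    suc n , a Vec.∷ x , b Vec.∷ y , c Vec.∷ z , cong (zipVenn ℕ._+_ (point a b c)) vennOf≡v

  realize : ∀ v → Realization v
  realize (venn (suc a) b c d e f g h) = extend true  true  true  (realize (venn a b c d e f g h))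
  realize (venn 0 (suc b) c d e f g h) = extend true  true  false (realize (venn 0 b c d e f g h))
  realize (venn 0 0 (suc c) d e f g h) = extend true  false true  (realize (venn 0 0 c d e f g h))
  realize (venn 0 0 0 (suc d) e f g h) = extend false true  true  (realize (venn 0 0 0 d e f g h))
  realize (venn 0 0 0 0 (suc e) f g h) = extend true  false false (realize (venn 0 0 0 0 e f g h))
  realize (venn 0 0 0 0 0 (suc f) g h) = extend false true  false (realize (venn 0 0 0 0 0 f g h))
  realize (venn 0 0 0 0 0 0 (suc g) h) = extend false false true  (realize (venn 0 0 0 0 0 0 g h))
  realize (venn 0 0 0 0 0 0 0 (suc h)) = extend false false false (realize (venn 0 0 0 0 0 0 0 h))
  realize (venn 0 0 0 0 0 0 0 0)       = 0 , Vec.[] , Vec.[] , Vec.[] , refl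

  quadProfile : ℤ → Quad → Profile
  quadProfile M (i , j , t , p) = profile (1ℤ + (M + M)) M M M i j t p

  Good : ℤ → Quad → Set
  Good M q = AllVenn (0ℤ ≤_) (regions (quadProfile M q))

  +S-size : ∀ m → + S-size m ≡ 1ℤ + (+ m + + m)
  +S-size m = cong (_+_ 1ℤ) (trans (pos-+ m (1 ℕ.* m)) (cong (λ k → + m + + k) (ℕₚ.*-identityˡ m)))

  InI-witness : ∀ {m n} q (x y z : Subset n) → profileOf x y z ≡ quadProfile (+ m) q → InI m q
  InI-witness {m} (i , j , t , p) x y z profile≡ with profile-injective profile≡
  ... | n≡ , x≡ , y≡ , z≡ , xy≡ , xz≡ , yz≡ , xyz≡ with +-injective (trans n≡ (sym (+S-size m)))
  ... | refl = x , y , z , +-injective x≡ , +-injective y≡ , +-injective z≡ ,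
               sym xy≡ , sym xz≡ , sym yz≡ , sym xyz≡

  InI⇔Good : ∀ m q → InI m q ⇔ Good (+ m) q
  InI⇔Good m q = mk⇔ to from
    where
    open ≡-Reasoning
    to : InI m q → Good (+ m) q
    to (x , y , z , ∣x∣≡m , ∣y∣≡m , ∣z∣≡m , refl , refl , refl , refl) =
      subst (AllVenn (0ℤ ≤_)) (sym regions≡vennOf) (toℤ-nonNegative (vennOf x y z))
      where
      regions≡vennOf : regions (quadProfile (+ m) q) ≡ toℤ (vennOf x y z)
      regions≡vennOf = begin
        regions (quadProfile (+ m) q)
          ≡⟨ cong regions (profile-≡ (sym (+S-size m))
               (cong +_ (sym ∣x∣≡m)) (cong +_ (sym ∣y∣≡m)) (cong +_ (sym ∣z∣≡m))
               refl refl refl refl) ⟩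
        regions (profileOf x y z)               ≡⟨ cong regions (profileOf-vennOf x y z) ⟩
        regions (sizes (toℤ (vennOf x y z)))    ≡⟨ regions-sizes _ ⟩
        toℤ (vennOf x y z)                      ∎
    from : Good (+ m) q → InI m q
    from good with realize (mapVenn ∣_∣ (regions (quadProfile (+ m) q)))
    ... | n , x , y , z , vennOf≡ = InI-witness q x y z (begin
      profileOf x y z                                      ≡⟨ profileOf-vennOf x y z ⟩
      sizes (toℤ (vennOf x y z))                           ≡⟨ cong (λ v → sizes (toℤ v)) vennOf≡ ⟩
      sizes (toℤ (mapVenn ∣_∣ (regions (quadProfile (+ m) q))))
        ≡⟨ cong sizes (toℤ-∣∣ _ good) ⟩
      sizes (regions (quadProfile (+ m) q))                ≡⟨ sizes-regions _ ⟩
      quadProfile (+ m) q                                  ∎)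

  ≤-by : ∀ {x y z} → 0ℤ ≤ z → z ≡ y - x → x ≤ y
  ≤-by 0≤z z≡y-x = 0≤i-j⇒j≤i (subst (0ℤ ≤_) z≡y-x 0≤z)

  0≤-by : ∀ {z w} → 0ℤ ≤ z → z ≡ w → 0ℤ ≤ w
  0≤-by 0≤z refl = 0≤z

  0≤+ : ∀ {a b} → 0ℤ ≤ a → 0ℤ ≤ b → 0ℤ ≤ a + b
  0≤+ = +-mono-≤

  -- RHS with + m generalized to M, which the ring solver can then treat as a variable.
  RHSℤ : ℤ → Quad → Set
  RHSℤ M (i , j , t , p) =
    (+ 0 ≤ i) × (i ≤ M) × (+ 0 ≤ j) × (j ≤ M) ×
    (((i + j) - M) ⊔ ((M - + 1) - (i + j)) ≤ t) ×
    (t ≤ M - + (∣ i - j ∣)) ×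
    ((+ 0 ⊔ ((i + j) - M)) ⊔ (((i + t) - M) ⊔ ((j + t) - M)) ≤ p) ×
    (p ≤ (i ⊓ j) ⊓ (t ⊓ (((i + j) + t + + 1) - M)))

  Good⇒RHSℤ : ∀ M q → Good M q → RHSℤ M q
  Good⇒RHSℤ M (i , j , t , p) (0≤p , 0≤i-p , 0≤j-p , 0≤t-p , 0≤x , 0≤y , 0≤z , 0≤none) =
    ≤-by (0≤+ 0≤p 0≤i-p) (solve (i ∷ p ∷ [])) ,
    ≤-by (0≤+ 0≤x 0≤j-p) (solve (M ∷ i ∷ j ∷ p ∷ [])) ,
    ≤-by (0≤+ 0≤p 0≤j-p) (solve (j ∷ p ∷ [])) ,
    ≤-by (0≤+ 0≤x 0≤i-p) (solve (M ∷ i ∷ j ∷ p ∷ [])) ,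
    ⊔-lub t-lower₁ t-lower₂ ,
    t-upper ,
    ⊔-lub (⊔-lub 0≤p p-lower₁) (⊔-lub p-lower₂ p-lower₃) ,
    ⊓-glb (⊓-glb (≤-by 0≤i-p refl) (≤-by 0≤j-p refl)) (⊓-glb (≤-by 0≤t-p refl) p-upper)
    where
    t-lower₁ : (i + j) - M ≤ t
    t-lower₁ = ≤-by (0≤+ 0≤x 0≤t-p) (solve (M ∷ i ∷ j ∷ t ∷ p ∷ []))
    t-lower₂ : (M - + 1) - (i + j) ≤ t
    t-lower₂ = ≤-by (0≤+ 0≤none 0≤p) (solve (M ∷ i ∷ j ∷ t ∷ p ∷ []))
    t-upper : t ≤ M - + ∣ i - j ∣
    t-upper with +∣i∣≡i⊎+∣i∣≡-i (i - j)
    ... | inj₁ eq rewrite eq = ≤-by (0≤+ 0≤y 0≤j-p) (solve (M ∷ i ∷ j ∷ t ∷ p ∷ []))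
    ... | inj₂ eq rewrite eq = ≤-by (0≤+ 0≤z 0≤i-p) (solve (M ∷ i ∷ j ∷ t ∷ p ∷ []))
    p-lower₁ : (i + j) - M ≤ p
    p-lower₁ = ≤-by 0≤x (solve (M ∷ i ∷ j ∷ p ∷ []))
    p-lower₂ : (i + t) - M ≤ p
    p-lower₂ = ≤-by 0≤y (solve (M ∷ i ∷ t ∷ p ∷ []))
    p-lower₃ : (j + t) - M ≤ p
    p-lower₃ = ≤-by 0≤z (solve (M ∷ j ∷ t ∷ p ∷ []))
    p-upper : p ≤ ((i + j) + t + + 1) - M
    p-upper = ≤-by 0≤none (solve (M ∷ i ∷ j ∷ t ∷ p ∷ []))

  RHSℤ⇒Good : ∀ M q → RHSℤ M q → Good M q
  RHSℤ⇒Good M (i , j , t , p) (_ , _ , _ , _ , _ , _ , lo , hi) =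
    ≤-trans (≤-trans (i≤i⊔j _ _) (i≤i⊔j _ _)) lo ,
    i≤j⇒0≤j-i (≤-trans hi (≤-trans (i⊓j≤i _ _) (i⊓j≤i _ _))) ,
    i≤j⇒0≤j-i (≤-trans hi (≤-trans (i⊓j≤i _ _) (i⊓j≤j _ _))) ,
    i≤j⇒0≤j-i (≤-trans hi (≤-trans (i⊓j≤j _ _) (i⊓j≤i _ _))) ,
    0≤-by (i≤j⇒0≤j-i (≤-trans (≤-trans (i≤j⊔i _ _) (i≤i⊔j _ _)) lo))
          (solve (M ∷ i ∷ j ∷ p ∷ [])) ,
    0≤-by (i≤j⇒0≤j-i (≤-trans (≤-trans (i≤i⊔j _ _) (i≤j⊔i _ _)) lo))
          (solve (M ∷ i ∷ t ∷ p ∷ [])) ,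
    0≤-by (i≤j⇒0≤j-i (≤-trans (≤-trans (i≤j⊔i _ _) (i≤j⊔i _ _)) lo))
          (solve (M ∷ j ∷ t ∷ p ∷ [])) ,
    0≤-by (i≤j⇒0≤j-i (≤-trans hi (≤-trans (i⊓j≤j _ _) (i⊓j≤j _ _))))
          (solve (M ∷ i ∷ j ∷ t ∷ p ∷ []))

  Good⇔RHSℤ : ∀ M q → Good M q ⇔ RHSℤ M q
  Good⇔RHSℤ M q = mk⇔ (Good⇒RHSℤ M q) (RHSℤ⇒Good M q)

  -- Enumerations and the lattice points of a simplex

  Enumerates : {A : Set} → (A → Set) → List A → Set
  Enumerates P xs = Unique xs × (∀ a → a ∈ xs ⇔ P a)

  Enumerates-resp : {A : Set} {P Q : A → Set} → (∀ a → P a ⇔ Q a) →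
    ∀ {xs} → Enumerates P xs → Enumerates Q xs
  Enumerates-resp P⇔Q (unique , ∈⇔P) = unique , λ a → P⇔Q a ⇔-∘ ∈⇔P a

  map-enumerates : {A B : Set} {P : A → Set} {Q : B → Set} (f : A → B) (g : B → A) →
    (∀ a → P a → Q (f a)) → (∀ b → Q b → P (g b)) →
    (∀ a → P a → g (f a) ≡ a) → (∀ b → Q b → f (g b) ≡ b) →
    ∀ {xs} → Enumerates P xs → Enumerates Q (map f xs)
  map-enumerates {P = P} {Q} f g f-pres g-pres g∘f f∘g {xs} (unique , ∈⇔P) =
    Unique.map⁻ (subst Unique (sym gfxs≡xs) unique) , λ b → mk⇔ (to b) (from b)
    where
    gfxs≡xs : map g (map f xs) ≡ xs
    gfxs≡xs = trans (sym (map-∘ xs))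
                    (map-id-local (tabulate (λ {a} a∈ → g∘f a (Equivalence.to (∈⇔P a) a∈))))
    to : ∀ b → b ∈ map f xs → Q b
    to b b∈ with ∈-map⁻ f b∈
    ... | a , a∈ , refl = f-pres a (Equivalence.to (∈⇔P a) a∈)
    from : ∀ b → Q b → b ∈ map f xs
    from b Qb = subst (_∈ map f xs) (f∘g b Qb)
                      (∈-map⁺ f (Equivalence.from (∈⇔P (g b)) (g-pres b Qb)))

  suc-head : ∀ {k} → Vec ℕ (suc k) → Vec ℕ (suc k)
  suc-head (a Vec.∷ v) = suc a Vec.∷ v

  simplex : (k n : ℕ) → List (Vec ℕ k)
  simplex zero    n       = Vec.[] ∷ []
  simplex (suc k) zero    = map (0 Vec.∷_) (simplex k zero)
  simplex (suc k) (suc n) = map (0 Vec.∷_) (simplex k (suc n)) ++ map suc-head (simplex (suc k) n)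

  length-simplex : ∀ k n → length (simplex k n) ≡ (n ℕ.+ k) C k
  length-simplex zero    n       = refl
  length-simplex (suc k) zero    = begin
    length (map (0 Vec.∷_) (simplex k zero)) ≡⟨ length-map _ (simplex k zero) ⟩
    length (simplex k zero)                  ≡⟨ length-simplex k zero ⟩
    k C k                                    ≡⟨ nCn≡1 k ⟩
    1                                        ≡⟨ nCn≡1 (suc k) ⟨
    suc k C suc k                            ∎
    where open ≡-Reasoning
  length-simplex (suc k) (suc n) = begin
    length (map (0 Vec.∷_) (simplex k (suc n)) ++ map suc-head (simplex (suc k) n))
      ≡⟨ length-++ (map (0 Vec.∷_) (simplex k (suc n))) ⟩
    length (map (0 Vec.∷_) (simplex k (suc n))) ℕ.+ length (map suc-head (simplex (suc k) n))
      ≡⟨ cong₂ ℕ._+_ (length-map _ (simplex k (suc n))) (length-map _ (simplex (suc k) n)) ⟩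
    length (simplex k (suc n)) ℕ.+ length (simplex (suc k) n)
      ≡⟨ cong₂ ℕ._+_ (length-simplex k (suc n)) (length-simplex (suc k) n) ⟩
    (suc n ℕ.+ k) C k ℕ.+ (n ℕ.+ suc k) C suc k
      ≡⟨ cong (λ l → l C k ℕ.+ (n ℕ.+ suc k) C suc k) (ℕₚ.+-suc n k) ⟨
    (n ℕ.+ suc k) C k ℕ.+ (n ℕ.+ suc k) C suc k
      ≡⟨ nCk+nC[k+1]≡[n+1]C[k+1] (n ℕ.+ suc k) k ⟩
    suc (n ℕ.+ suc k) C suc k ∎
    where open ≡-Reasoning

  ∈-simplex⁻ : ∀ k n {v} → v ∈ simplex k n → sum v ℕ.≤ n
  ∈-simplex⁻ zero    n       {Vec.[]} _ = z≤n
  ∈-simplex⁻ (suc k) zero    v∈ with ∈-map⁻ (0 Vec.∷_) v∈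
  ... | _ , w∈ , refl = ∈-simplex⁻ k zero w∈
  ∈-simplex⁻ (suc k) (suc n) v∈ with ∈-++⁻ (map (0 Vec.∷_) (simplex k (suc n))) v∈
  ... | inj₁ v∈₀ with ∈-map⁻ (0 Vec.∷_) v∈₀
  ...   | _ , w∈ , refl = ∈-simplex⁻ k (suc n) w∈
  ∈-simplex⁻ (suc k) (suc n) v∈ | inj₂ v∈₊ with ∈-map⁻ suc-head v∈₊
  ...   | (_ Vec.∷ _) , w∈ , refl = s≤s (∈-simplex⁻ (suc k) n w∈)

  ∈-simplex⁺ : ∀ k n (v : Vec ℕ k) → sum v ℕ.≤ n → v ∈ simplex k n
  ∈-simplex⁺ zero    n       Vec.[]           _  = here refl
  ∈-simplex⁺ (suc k) zero    (zero Vec.∷ v)   s≤ = ∈-map⁺ (0 Vec.∷_) (∈-simplex⁺ k zero v s≤)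
  ∈-simplex⁺ (suc k) (suc n) (zero Vec.∷ v)   s≤ =
    ∈-++⁺ˡ (∈-map⁺ (0 Vec.∷_) (∈-simplex⁺ k (suc n) v s≤))
  ∈-simplex⁺ (suc k) (suc n) (suc a Vec.∷ v) (s≤s s≤) =
    ∈-++⁺ʳ (map (0 Vec.∷_) (simplex k (suc n)))
           (∈-map⁺ suc-head (∈-simplex⁺ (suc k) n (a Vec.∷ v) s≤))

  simplex-unique : ∀ k n → Unique (simplex k n)
  simplex-unique zero    n       = [] ∷ []
  simplex-unique (suc k) zero    = Unique.map⁺ ∷-injectiveʳ (simplex-unique k zero)
  simplex-unique (suc k) (suc n) =
    Unique.++⁺ (Unique.map⁺ ∷-injectiveʳ (simplex-unique k (suc n)))
               (Unique.map⁺ suc-head-injective (simplex-unique (suc k) n)) disjoint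
    where
    suc-head-injective : ∀ {v w : Vec ℕ (suc k)} → suc-head v ≡ suc-head w → v ≡ w
    suc-head-injective {_ Vec.∷ _} {_ Vec.∷ _} refl = refl
    disjoint : ∀ {v} →
      ¬ (v ∈ map (0 Vec.∷_) (simplex k (suc n)) × v ∈ map suc-head (simplex (suc k) n))
    disjoint (v∈₀ , v∈₊) with ∈-map⁻ (0 Vec.∷_) v∈₀ | ∈-map⁻ suc-head v∈₊
    ... | _ , _ , refl | (_ Vec.∷ _) , _ , ()

  simplex-enumerates : ∀ k n → Enumerates (λ v → sum v ℕ.≤ n) (simplex k n)
  simplex-enumerates k n = simplex-unique k n , λ v → mk⇔ (∈-simplex⁻ k n) (∈-simplex⁺ k n v)

  -- A bijection between the lattice points of the simplex and the realizable quadruples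

  0≤-absurd : ∀ {z} → 0ℤ ≤ z → z ≡ - + 1 → ⊥
  0≤-absurd () refl

  ≰⇒0≤-1 : ∀ {x y} → ¬ x ≤ y → 0ℤ ≤ x - y - + 1
  ≰⇒0≤-1 {x} {y} x≰y =
    0≤-by {z = x - (+ 1 + y)} (i≤j⇒0≤j-i (i<j⇒suc[i]≤j (≰⇒> x≰y))) (solve (x ∷ y ∷ []))

  quad-≡ : ∀ {i j t p i′ j′ t′ p′ : ℤ} → i ≡ i′ → j ≡ j′ → t ≡ t′ → p ≡ p′ →
    (i , j , t , p) ≡ (i′ , j′ , t′ , p′)
  quad-≡ refl refl refl refl = refl

  InSimplex : ℤ → Quad → Set
  InSimplex M (a , b , c , d) = 0ℤ ≤ a × 0ℤ ≤ b × 0ℤ ≤ c × 0ℤ ≤ d × a + b + c + d ≤ M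

  UpperPoint : ℤ → Quad → Set
  UpperPoint M (a , b , c , d) = a + a + b + c + d + + 2 ≤ M

  data Pairs (M : ℤ) : Quad → Quad → Set where
    lower : ∀ {a b c d} → ¬ UpperPoint M (a , b , c , d) →
            Pairs M (a , b , c , d) (a + b , a + c , a + d , a)
    upper : ∀ {a b c d} → UpperPoint M (a , b , c , d) →
            let k = M - (a + a + b + c + d + + 2) in
            Pairs M (a , b , c , d) (k + (a + b + + 1) , k + (a + c + + 1) , k + (a + d + + 1) , k)

  pair : ∀ M v → Σ Quad (Pairs M v)
  pair M (a , b , c , d) with a + a + b + c + d + + 2 ≤? M
  ... | yes upperPoint = _ , upper upperPoint
  ... | no ¬upperPoint = _ , lower ¬upperPoint

  toGood : ℤ → Quad → Quad
  toGood M v = proj₁ (pair M v)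

  Pairs-functional : ∀ {M v q q′} → Pairs M v q → Pairs M v q′ → q ≡ q′
  Pairs-functional (lower _)           (lower _)           = refl
  Pairs-functional (upper _)           (upper _)           = refl
  Pairs-functional (lower ¬upperPoint) (upper upperPoint)  = ⊥-elim (¬upperPoint upperPoint)
  Pairs-functional (upper upperPoint)  (lower ¬upperPoint) = ⊥-elim (¬upperPoint upperPoint)

  Pairs-respʳ : ∀ {M v q q′} → Pairs M v q → q ≡ q′ → Pairs M v q′
  Pairs-respʳ vq refl = vq

  Pairs-good : ∀ {M v q} → InSimplex M v → Pairs M v q → Good M q
  Pairs-good {M} {a , b , c , d} (0≤a , 0≤b , 0≤c , 0≤d , Σ≤M) (lower ¬upperPoint) =
    0≤a ,
    0≤-by 0≤b (solve (a ∷ b ∷ [])) ,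
    0≤-by 0≤c (solve (a ∷ c ∷ [])) ,
    0≤-by 0≤d (solve (a ∷ d ∷ [])) ,
    0≤-by (0≤+ (i≤j⇒0≤j-i Σ≤M) 0≤d) (solve (M ∷ a ∷ b ∷ c ∷ d ∷ [])) ,
    0≤-by (0≤+ (i≤j⇒0≤j-i Σ≤M) 0≤c) (solve (M ∷ a ∷ b ∷ c ∷ d ∷ [])) ,
    0≤-by (0≤+ (i≤j⇒0≤j-i Σ≤M) 0≤b) (solve (M ∷ a ∷ b ∷ c ∷ d ∷ [])) ,
    0≤-by (≰⇒0≤-1 ¬upperPoint) (solve (M ∷ a ∷ b ∷ c ∷ d ∷ []))
  Pairs-good {M} {a , b , c , d} (0≤a , 0≤b , 0≤c , 0≤d , Σ≤M) (upper upperPoint) =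
    i≤j⇒0≤j-i upperPoint ,
    0≤-by (0≤+ (0≤+ 0≤a 0≤b) 0≤1) (solve (M ∷ a ∷ b ∷ c ∷ d ∷ [])) ,
    0≤-by (0≤+ (0≤+ 0≤a 0≤c) 0≤1) (solve (M ∷ a ∷ b ∷ c ∷ d ∷ [])) ,
    0≤-by (0≤+ (0≤+ 0≤a 0≤d) 0≤1) (solve (M ∷ a ∷ b ∷ c ∷ d ∷ [])) ,
    0≤-by 0≤d (solve (M ∷ a ∷ b ∷ c ∷ d ∷ [])) ,
    0≤-by 0≤c (solve (M ∷ a ∷ b ∷ c ∷ d ∷ [])) ,
    0≤-by 0≤b (solve (M ∷ a ∷ b ∷ c ∷ d ∷ [])) ,
    0≤-by (i≤j⇒0≤j-i Σ≤M) (solve (M ∷ a ∷ b ∷ c ∷ d ∷ []))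
    where
    0≤1 : 0ℤ ≤ 1ℤ
    0≤1 = +≤+ z≤n

  LowerQuad : ℤ → Quad → Set
  LowerQuad M (i , j , t , p) = i + j + t - p - p ≤ M

  lower⁻¹ : Quad → Quad
  lower⁻¹ (i , j , t , p) = p , i - p , j - p , t - p

  upper⁻¹ : ℤ → Quad → Quad
  upper⁻¹ M (i , j , t , p) =
    i + j + t - p - p - M - + 1 , M - j - t + p , M - i - t + p , M - i - j + p

  toSimplex : ℤ → Quad → Quad
  toSimplex M q@(i , j , t , p) with i + j + t - p - p ≤? M
  ... | yes _ = lower⁻¹ q
  ... | no  _ = upper⁻¹ M q

  toSimplex-lower : ∀ {M} q → LowerQuad M q → toSimplex M q ≡ lower⁻¹ q
  toSimplex-lower {M} (i , j , t , p) lowerQuad with i + j + t - p - p ≤? M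
  ... | yes _         = refl
  ... | no ¬lowerQuad = ⊥-elim (¬lowerQuad lowerQuad)

  toSimplex-upper : ∀ {M} q → ¬ LowerQuad M q → toSimplex M q ≡ upper⁻¹ M q
  toSimplex-upper {M} (i , j , t , p) ¬lowerQuad with i + j + t - p - p ≤? M
  ... | yes lowerQuad = ⊥-elim (¬lowerQuad lowerQuad)
  ... | no _          = refl

  Pairs-inverse : ∀ {M v q} → InSimplex M v → Pairs M v q → toSimplex M q ≡ v
  Pairs-inverse {M} {a , b , c , d} (_ , _ , _ , _ , Σ≤M) (lower _) =
    trans (toSimplex-lower _ (≤-by (i≤j⇒0≤j-i Σ≤M) (solve (M ∷ a ∷ b ∷ c ∷ d ∷ []))))
          (quad-≡ refl (solve (a ∷ b ∷ [])) (solve (a ∷ c ∷ [])) (solve (a ∷ d ∷ [])))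
  Pairs-inverse {M} {a , b , c , d} (0≤a , _ , _ , _ , _) (upper _) =
    trans (toSimplex-upper _ (λ lowerQuad → 0≤-absurd (0≤+ (i≤j⇒0≤j-i lowerQuad) 0≤a)
                                                       (solve (M ∷ a ∷ b ∷ c ∷ d ∷ []))))
          (quad-≡ (solve (M ∷ a ∷ b ∷ c ∷ d ∷ [])) (solve (M ∷ a ∷ b ∷ c ∷ d ∷ []))
                  (solve (M ∷ a ∷ b ∷ c ∷ d ∷ [])) (solve (M ∷ a ∷ b ∷ c ∷ d ∷ [])))

  toSimplex-sound : ∀ {M} q → Good M q →
    InSimplex M (toSimplex M q) × Pairs M (toSimplex M q) q
  toSimplex-sound {M} (i , j , t , p) (0≤p , 0≤i-p , 0≤j-p , 0≤t-p , 0≤x , 0≤y , 0≤z , 0≤none)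
    with i + j + t - p - p ≤? M
  ... | yes lowerQuad =
    (0≤p , 0≤i-p , 0≤j-p , 0≤t-p , sum≤M) ,
    Pairs-respʳ (lower (λ upperPoint → 0≤-absurd (0≤+ 0≤none (i≤j⇒0≤j-i upperPoint))
                                                 (solve (M ∷ i ∷ j ∷ t ∷ p ∷ []))))
                (quad-≡ (solve (i ∷ p ∷ [])) (solve (j ∷ p ∷ [])) (solve (t ∷ p ∷ [])) refl)
    where
    sum≤M : p + (i - p) + (j - p) + (t - p) ≤ M
    sum≤M = ≤-by (i≤j⇒0≤j-i lowerQuad) (solve (M ∷ i ∷ j ∷ t ∷ p ∷ []))
  ... | no ¬lowerQuad =
    (≰⇒0≤-1 ¬lowerQuad , 0≤z , 0≤y , 0≤x , sum≤M) ,
    Pairs-respʳ (upper (≤-by 0≤p (solve (M ∷ i ∷ j ∷ t ∷ p ∷ []))))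
                (quad-≡ (solve (M ∷ i ∷ j ∷ t ∷ p ∷ [])) (solve (M ∷ i ∷ j ∷ t ∷ p ∷ []))
                        (solve (M ∷ i ∷ j ∷ t ∷ p ∷ [])) (solve (M ∷ i ∷ j ∷ t ∷ p ∷ [])))
    where
    sum≤M : i + j + t - p - p - M - + 1 + (M - j - t + p) + (M - i - t + p) + (M - i - j + p) ≤ M
    sum≤M = ≤-by 0≤none (solve (M ∷ i ∷ j ∷ t ∷ p ∷ []))

  toℤ⁴ : Vec ℕ 4 → Quad
  toℤ⁴ (a Vec.∷ b Vec.∷ c Vec.∷ d Vec.∷ Vec.[]) = + a , + b , + c , + d

  fromℤ⁴ : Quad → Vec ℕ 4
  fromℤ⁴ (a , b , c , d) = ∣ a ∣ Vec.∷ ∣ b ∣ Vec.∷ ∣ c ∣ Vec.∷ ∣ d ∣ Vec.∷ Vec.[]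

  sum₄ : ∀ a b c d → sum (a Vec.∷ b Vec.∷ c Vec.∷ d Vec.∷ Vec.[]) ≡ a ℕ.+ b ℕ.+ c ℕ.+ d
  sum₄ a b c d =
    trans (cong (λ k → a ℕ.+ (b ℕ.+ (c ℕ.+ k))) (ℕₚ.+-identityʳ d))
          (sym (trans (ℕₚ.+-assoc (a ℕ.+ b) c d) (ℕₚ.+-assoc a b (c ℕ.+ d))))

  toℤ⁴-inSimplex : ∀ {m} v → sum v ℕ.≤ m → InSimplex (+ m) (toℤ⁴ v)
  toℤ⁴-inSimplex {m} (a Vec.∷ b Vec.∷ c Vec.∷ d Vec.∷ Vec.[]) sum≤m =
    +≤+ z≤n , +≤+ z≤n , +≤+ z≤n , +≤+ z≤n , +≤+ (subst (ℕ._≤ m) (sum₄ a b c d) sum≤m)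

  fromℤ⁴-sum : ∀ {m} q → InSimplex (+ m) q → sum (fromℤ⁴ q) ℕ.≤ m
  fromℤ⁴-sum {m} (a , b , c , d) (0≤a , 0≤b , 0≤c , 0≤d , Σ≤m) =
    subst (ℕ._≤ m) (sym (sum₄ (∣ a ∣) (∣ b ∣) (∣ c ∣) (∣ d ∣)))
          (drop‿+≤+ (subst (_≤ + m) (sym +sum≡) Σ≤m))
    where
    +sum≡ : + ∣ a ∣ + + ∣ b ∣ + + ∣ c ∣ + + ∣ d ∣ ≡ a + b + c + d
    +sum≡ = cong₂ _+_ (cong₂ _+_ (cong₂ _+_ (0≤i⇒+∣i∣≡i 0≤a) (0≤i⇒+∣i∣≡i 0≤b)) (0≤i⇒+∣i∣≡i 0≤c))
                      (0≤i⇒+∣i∣≡i 0≤d)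

  toℤ⁴-fromℤ⁴ : ∀ {M} q → InSimplex M q → toℤ⁴ (fromℤ⁴ q) ≡ q
  toℤ⁴-fromℤ⁴ (a , b , c , d) (0≤a , 0≤b , 0≤c , 0≤d , _) =
    quad-≡ (0≤i⇒+∣i∣≡i 0≤a) (0≤i⇒+∣i∣≡i 0≤b) (0≤i⇒+∣i∣≡i 0≤c) (0≤i⇒+∣i∣≡i 0≤d)

  simplexToQuad : ℕ → Vec ℕ 4 → Quad
  simplexToQuad m v = toGood (+ m) (toℤ⁴ v)

  good-enumeration : ∀ m → Enumerates (Good (+ m)) (map (simplexToQuad m) (simplex 4 m))
  good-enumeration m = map-enumerates F G F-good G-simplex G∘F F∘G (simplex-enumerates 4 m)
    where
    F : Vec ℕ 4 → Quad
    F = simplexToQuad m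
    G : Quad → Vec ℕ 4
    G q = fromℤ⁴ (toSimplex (+ m) q)
    F-good : ∀ v → sum v ℕ.≤ m → Good (+ m) (F v)
    F-good v sum≤m = Pairs-good (toℤ⁴-inSimplex v sum≤m) (proj₂ (pair (+ m) (toℤ⁴ v)))
    G-simplex : ∀ q → Good (+ m) q → sum (G q) ℕ.≤ m
    G-simplex q good = fromℤ⁴-sum _ (proj₁ (toSimplex-sound {+ m} q good))
    G∘F : ∀ v → sum v ℕ.≤ m → G (F v) ≡ v
    G∘F v@(_ Vec.∷ _ Vec.∷ _ Vec.∷ _ Vec.∷ Vec.[]) sum≤m =
      cong fromℤ⁴ (Pairs-inverse (toℤ⁴-inSimplex v sum≤m) (proj₂ (pair (+ m) (toℤ⁴ v))))
    F∘G : ∀ q → Good (+ m) q → F (G q) ≡ q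
    F∘G q good =
      let inSimplex , pairs = toSimplex-sound {+ m} q good in
      trans (cong (toGood (+ m)) (toℤ⁴-fromℤ⁴ _ inSimplex))
            (Pairs-functional (proj₂ (pair (+ m) (toSimplex (+ m) q))) pairs)

open import Data.Nat using (_+_)

proposition3p1 : (m : ℕ) → m ≥ 1 →
    ((q : Quad) → InI m q ⇔ RHS m q) ×
    (∃[ L ] (Unique L × ((q : Quad) → q ∈ L ⇔ InI m q) × length L ≡ (m + 4) C 4))
proposition3p1 m _ =
  (λ q → Good⇔RHSℤ (+ m) q ⇔-∘ InI⇔Good m q) ,
  (L , unique , ∈⇔InI , trans (length-map _ (simplex 4 m)) (length-simplex 4 m))
  where
  L : List Quad
  L = map (simplexToQuad m) (simplex 4 m)
  enumeration : Enumerates (InI m) L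
  enumeration = Enumerates-resp (λ q → ⇔-sym (InI⇔Good m q)) (good-enumeration m)
  unique : Unique L
  unique = proj₁ enumeration
  ∈⇔InI : ∀ q → q ∈ L ⇔ InI m q
  ∈⇔InI = proj₂ enumeration
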